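{- Let $A,B$ be variables and define $\alpha_n,\beta_n\in\mathbb{Z}_{(p)}[A,B,B^{ -1}]$ for $1\le n\le p-1$ by $\alpha_1=\frac{A}{2B}$, $\beta_1=0$, $\alpha_2=-\frac{A^2}{8B^2}$, $\beta_2=\frac{A}{4B}$, $\alpha_3=\frac{A^3}{16B^3}+\frac{1}{2B}$, $\beta_3=-\frac{A^2}{8B^2}$, $\alpha_4=-\frac{5A^4}{128B^4}-\frac{A}{4B^2}$, $\beta_4=\frac{5A^3}{64B^3}+\frac{3}{8B}$, and for $5\le n\le p-1$: $\alpha_n=-\frac{2n-3}{2n}\frac{A}{B}\alpha_{n-1}-\frac{2n-9}{2n}\frac1B\alpha_{n-3}$, $\beta_n=-\frac{2n-3}{2n}\frac{A}{B}\beta_{n-1}-\frac{2n-9}{2n}\frac1B\beta_{n-3}$. For $1\le n\le p-2$ let $\psi_n=\alpha_n\beta_{n+1}-\alpha_{n+1}\beta_n$. Then for every $n$ with $1\le n\le\frac{p-3}{2}$ there are weighted homogeneous polynomials $\Psi_{2n},\Psi_{2n-1}\in\mathbb{Z}_{(p)}[z_4,z_6]$ of degrees $4n$ and $4n+4$ respectively (with $z_4,z_6$ of weights $4,6$) such that $\psi_{2n}=\Psi_{2n}(A,B)/B^{2n}$ and $\psi_{2n-1}=\Psi_{2n-1}(A,B)/B^{2n}$.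
   Context: $p$ is a prime, $p\neq2,3$; $\mathbb{Z}_{(p)}$ is the localization of $\mathbb{Z}$ at $p$. (In the paper $A=a^p$, $B=b^p$, and $\alpha_n,\beta_n$ are the coefficients of $v_0$ and $\theta$ in the solution $v_n$ of a certain triangular linear system.) -}

module Defs where

open import Data.Nat as ℕ using (ℕ; zero; suc)
open import Data.Integer as ℤ using (ℤ; +_; -[1+_])
open import Data.Rational as ℚ using (ℚ; _/_; ↧ₙ_; 0ℚ)
open import Data.Product using (_×_; _,_)
open import Data.List using (List; []; _∷_; _++_; map; concatMap; foldr)
open import Data.List.Relation.Unary.All using (All)
open import Data.Nat.Divisibility using (_∣_)
open import Relation.Binary.PropositionalEquality using (_≡_)
open import Relation.Nullary using (¬_; yes; no)

-- Elements of ℚ[A,B,B⁻¹] (which contains ℤ_(p)[A,B,B⁻¹]) as finite lists of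
-- monomials (c , i , j) standing for c · A^i · B^j  (i : ℕ, j : ℤ).
LPoly : Set
LPoly = List (ℚ × ℕ × ℤ)

mono : ℚ → ℕ → ℤ → LPoly
mono c i j = (c , i , j) ∷ []

infixl 6 _⊕_ _⊖_
infixl 7 _⊗_

_⊕_ : LPoly → LPoly → LPoly
f ⊕ g = f ++ g

neg : LPoly → LPoly
neg = map (λ { (c , i , j) → (ℚ.- c , i , j) })

_⊖_ : LPoly → LPoly → LPoly
f ⊖ g = f ⊕ neg g

_⊗_ : LPoly → LPoly → LPoly
f ⊗ g = concatMap (λ { (c , i , j) → map (λ { (d , k , l) → (c ℚ.* d , i ℕ.+ k , j ℤ.+ l) }) g }) f

coeff : LPoly → ℕ → ℤ → ℚ
coeff [] i j = 0ℚ
coeff ((c , k , l) ∷ f) i j with k ℕ.≟ i | l ℤ.≟ j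
... | yes _ | yes _ = c ℚ.+ coeff f i j
... | _     | _     = coeff f i j

infix 4 _≈_
_≈_ : LPoly → LPoly → Set
f ≈ g = ∀ i j → coeff f i j ≡ coeff g i j

-- the sequences α_n, β_n (values at n = 0 are irrelevant placeholders)
α : ℕ → LPoly
α 0 = []
α 1 = mono (+ 1 / 2) 1 (ℤ.- + 1)
α 2 = mono ((ℤ.- + 1) / 8) 2 (ℤ.- + 2)
α 3 = mono (+ 1 / 16) 3 (ℤ.- + 3) ⊕ mono (+ 1 / 2) 0 (ℤ.- + 1)
α 4 = mono ((ℤ.- + 5) / 128) 4 (ℤ.- + 4) ⊕ mono ((ℤ.- + 1) / 4) 1 (ℤ.- + 2)
α n@(suc (suc (suc (suc (suc m))))) =
  mono (ℚ.- ((+ (2 ℕ.* n) ℤ.- + 3) / (2 ℕ.* n))) 1 (ℤ.- + 1) ⊗ α (suc (suc (suc (suc m))))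
  ⊖ mono ((+ (2 ℕ.* n) ℤ.- + 9) / (2 ℕ.* n)) 0 (ℤ.- + 1) ⊗ α (suc (suc m))

β : ℕ → LPoly
β 0 = []
β 1 = []
β 2 = mono (+ 1 / 4) 1 (ℤ.- + 1)
β 3 = mono ((ℤ.- + 1) / 8) 2 (ℤ.- + 2)
β 4 = mono (+ 5 / 64) 3 (ℤ.- + 3) ⊕ mono (+ 3 / 8) 0 (ℤ.- + 1)
β n@(suc (suc (suc (suc (suc m))))) =
  mono (ℚ.- ((+ (2 ℕ.* n) ℤ.- + 3) / (2 ℕ.* n))) 1 (ℤ.- + 1) ⊗ β (suc (suc (suc (suc m))))
  ⊖ mono ((+ (2 ℕ.* n) ℤ.- + 9) / (2 ℕ.* n)) 0 (ℤ.- + 1) ⊗ β (suc (suc m))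

ψ : ℕ → LPoly
ψ n = α n ⊗ β (suc n) ⊖ α (suc n) ⊗ β n

-- polynomials in ℚ[z₄,z₆] as lists of monomials (c , i , j) = c · z₄^i · z₆^j
Poly2 : Set
Poly2 = List (ℚ × ℕ × ℕ)

InZp : ℕ → ℚ → Set
InZp p q = ¬ (p ∣ ↧ₙ q)

IsWHomZp : ℕ → ℕ → Poly2 → Set
IsWHomZp p d Ψ = All (λ { (c , i , j) → InZp p c × (4 ℕ.* i ℕ.+ 6 ℕ.* j ≡ d) }) Ψ

-- Ψ(A,B) / B^k as an element of ℚ[A,B,B⁻¹]
evalDivB : Poly2 → ℕ → LPoly
evalDivB Ψ k = map (λ { (c , i , j) → (c , i , + j ℤ.- + k) }) Ψ

module Submission where

-- Idea: ψ_n = α_nβ_{n+1} − α_{n+1}β_n is the Casoratian of two solutions of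
-- one linear three-term recurrence, so it satisfies a recurrence of its own,
--   ψ_{5+m} = q₁ m · A/B² · ψ_{3+m} + q₂ m · 1/B² · ψ_{2+m},
-- whose rational coefficients only have denominators 2k·2k′ with k, k′ < p.
-- Starting from the explicitly computed ψ₁, …, ψ₄, this recurrence defines the
-- numerators Ψ by simultaneous induction over even and odd indices; a step
-- multiplies by z₄ or by z₆ and by an element of ℤ_(p), which preserves
-- weighted homogeneity and p-integrality.

open import Defs
open import Data.Nat using (ℕ; _*_; _+_; _∸_; _≤_)
open import Data.Nat.DivMod using (_/_)
open import Data.Nat.Primality using (Prime)
open import Data.Product using (Σ; _×_)
open import Relation.Binary.PropositionalEquality using (_≢_)

open import Data.Nat as ℕ using (zero; suc; _<_)
import Data.Nat.Properties as ℕP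
import Data.Nat.DivMod as ℕDivMod
open import Data.Nat.Divisibility using (_∣_; divides; ∣-trans; ∣⇒≤)
open import Data.Nat.Primality using (euclidsLemma)
open import Data.Nat.Tactic.RingSolver using (solve-∀)
open import Data.Integer as ℤ using (ℤ; +_; -[1+_])
import Data.Integer.Properties as ℤP
import Data.Integer.Solver
open import Data.Rational as ℚ using (ℚ; 0ℚ; 1ℚ)
import Data.Rational.Properties as ℚP
open import Data.Product using (_,_; proj₁; proj₂)
import Data.Sum
open import Data.Sum using (_⊎_; inj₁; inj₂)
import Data.Maybe
open import Data.List using ([]; _∷_; _++_; map)
import Data.List.Properties as ListP
open import Data.List.Relation.Unary.All using (All; []; _∷_; all?)
import Data.List.Relation.Unary.All.Properties as AllP
open import Data.Empty using (⊥-elim)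
open import Relation.Nullary using (¬_; yes; no; Dec)
open import Relation.Nullary.Decidable using (dec⇒maybe; True; toWitness)
open import Relation.Binary.PropositionalEquality
  using (_≡_; refl; sym; trans; cong; cong₂; subst; module ≡-Reasoning)
open import Relation.Binary.Structures using (IsEquivalence)
open import Algebra.Bundles using (CommutativeRing; CommutativeMonoid; AbelianGroup)
open import Algebra.Properties.CommutativeSemigroup
  (CommutativeMonoid.commutativeSemigroup ℚP.+-0-commutativeMonoid) using (interchange)
open import Algebra.Properties.Group (AbelianGroup.group ℤP.+-0-abelianGroup)
  using () renaming (∙-cancelˡ to ℤ-+-cancelˡ; //-rightDividesˡ to ℤ-[j-l]+l≡j)
import Algebra.Solver.Ring.AlmostCommutativeRing as SolverRing
import Algebra.Solver.Ring

coeff-++ : ∀ f g i j → coeff (f ++ g) i j ≡ coeff f i j ℚ.+ coeff g i j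
coeff-++ [] g i j = sym (ℚP.+-identityˡ _)
coeff-++ ((c , k , l) ∷ f) g i j with k ℕ.≟ i | l ℤ.≟ j
... | yes _ | yes _ = trans (cong (c ℚ.+_) (coeff-++ f g i j)) (sym (ℚP.+-assoc c _ _))
... | yes _ | no _  = coeff-++ f g i j
... | no _  | _     = coeff-++ f g i j

coeff-neg : ∀ f i j → coeff (neg f) i j ≡ ℚ.- coeff f i j
coeff-neg [] i j = refl
coeff-neg ((c , k , l) ∷ f) i j with k ℕ.≟ i | l ℤ.≟ j
... | yes _ | yes _ = trans (cong (ℚ.- c ℚ.+_) (coeff-neg f i j)) (sym (ℚP.neg-distrib-+ c _))
... | yes _ | no _  = coeff-neg f i j
... | no _  | _     = coeff-neg f i j

coeff-mono : ∀ c k l i j → coeff (mono c k l) i j ≡ c ℚ.* coeff (mono 1ℚ k l) i j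
coeff-mono c k l i j with k ℕ.≟ i | l ℤ.≟ j
... | yes _ | yes _ = begin
  c ℚ.+ 0ℚ             ≡⟨ ℚP.+-identityʳ c ⟩
  c                    ≡⟨ sym (ℚP.*-identityʳ c) ⟩
  c ℚ.* 1ℚ             ≡⟨ cong (c ℚ.*_) (sym (ℚP.+-identityʳ 1ℚ)) ⟩
  c ℚ.* (1ℚ ℚ.+ 0ℚ)    ∎
  where open ≡-Reasoning
... | yes _ | no _  = sym (ℚP.*-zeroʳ c)
... | no _  | _     = sym (ℚP.*-zeroʳ c)

mono-+ : ∀ a b k l → mono (a ℚ.+ b) k l ≈ mono a k l ⊕ mono b k l
mono-+ a b k l i j = begin
  coeff (mono (a ℚ.+ b) k l) i j                         ≡⟨ coeff-mono (a ℚ.+ b) k l i j ⟩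
  (a ℚ.+ b) ℚ.* e                                        ≡⟨ ℚP.*-distribʳ-+ e a b ⟩
  a ℚ.* e ℚ.+ b ℚ.* e                                    ≡⟨ sym (cong₂ ℚ._+_ (coeff-mono a k l i j) (coeff-mono b k l i j)) ⟩
  coeff (mono a k l) i j ℚ.+ coeff (mono b k l) i j      ≡⟨ sym (coeff-++ (mono a k l) (mono b k l) i j) ⟩
  coeff (mono a k l ⊕ mono b k l) i j                    ∎
  where
  open ≡-Reasoning
  e = coeff (mono 1ℚ k l) i j

mono-0 : ∀ k l → mono 0ℚ k l ≈ []
mono-0 k l i j = trans (coeff-mono 0ℚ k l i j) (ℚP.*-zeroˡ (coeff (mono 1ℚ k l) i j))

⊗-∷ : ∀ c k l f g → ((c , k , l) ∷ f) ⊗ g ≡ mono c k l ⊗ g ++ f ⊗ g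
⊗-∷ c k l f g = cong (_++ f ⊗ g) (sym (ListP.++-identityʳ _))

++-⊗ : ∀ f g h → (f ++ g) ⊗ h ≡ f ⊗ h ++ g ⊗ h
++-⊗ [] g h = refl
++-⊗ ((c , k , l) ∷ f) g h = trans (⊗-∷ c k l (f ++ g) h) (trans (cong (mono c k l ⊗ h ++_) (++-⊗ f g h))
  (trans (sym (ListP.++-assoc (mono c k l ⊗ h) (f ⊗ h) (g ⊗ h))) (cong (_++ g ⊗ h) (sym (⊗-∷ c k l f h)))))

mono-⊗-++ : ∀ c k l f g → mono c k l ⊗ (f ++ g) ≡ mono c k l ⊗ f ++ mono c k l ⊗ g
mono-⊗-++ c k l [] g = refl
mono-⊗-++ c k l (t ∷ f) g = cong (_ ∷_) (mono-⊗-++ c k l f g)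

⊗-[] : ∀ f → f ⊗ [] ≡ []
⊗-[] [] = refl
⊗-[] (t ∷ f) = ⊗-[] f

mono-⊗-mono : ∀ c k l g → mono c k l ⊗ g ≡ g ⊗ mono c k l
mono-⊗-mono c k l [] = refl
mono-⊗-mono c k l ((d , k′ , l′) ∷ g) =
  cong₂ _∷_ (cong₂ _,_ (ℚP.*-comm c d) (cong₂ _,_ (ℕP.+-comm k k′) (ℤP.+-comm l l′))) (mono-⊗-mono c k l g)

mono-⊗-assoc : ∀ c k l d k′ l′ h →
  mono (c ℚ.* d) (k ℕ.+ k′) (l ℤ.+ l′) ⊗ h ≡ mono c k l ⊗ (mono d k′ l′ ⊗ h)
mono-⊗-assoc c k l d k′ l′ [] = refl
mono-⊗-assoc c k l d k′ l′ ((e , k″ , l″) ∷ h) =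
  cong₂ _∷_ (cong₂ _,_ (ℚP.*-assoc c d e) (cong₂ _,_ (ℕP.+-assoc k k′ k″) (ℤP.+-assoc l l′ l″)))
    (mono-⊗-assoc c k l d k′ l′ h)

coeff-∷-⊗ : ∀ c k l f g i j →
  coeff (((c , k , l) ∷ f) ⊗ g) i j ≡ coeff (mono c k l ⊗ g) i j ℚ.+ coeff (f ⊗ g) i j
coeff-∷-⊗ c k l f g i j = trans (cong (λ h → coeff h i j) (⊗-∷ c k l f g)) (coeff-++ (mono c k l ⊗ g) _ i j)

⊗-distribˡ : ∀ f g h → f ⊗ (g ⊕ h) ≈ f ⊗ g ⊕ f ⊗ h
⊗-distribˡ [] g h i j = refl
⊗-distribˡ ((c , k , l) ∷ f) g h i j = begin
  coeff (((c , k , l) ∷ f) ⊗ (g ++ h)) i j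
    ≡⟨ coeff-∷-⊗ c k l f (g ++ h) i j ⟩
  coeff (mono c k l ⊗ (g ++ h)) i j ℚ.+ coeff (f ⊗ (g ++ h)) i j
    ≡⟨ cong₂ ℚ._+_ (trans (cong (λ x → coeff x i j) (mono-⊗-++ c k l g h)) (coeff-++ (mono c k l ⊗ g) _ i j))
                   (trans (⊗-distribˡ f g h i j) (coeff-++ (f ⊗ g) _ i j)) ⟩
  (coeff (mono c k l ⊗ g) i j ℚ.+ coeff (mono c k l ⊗ h) i j) ℚ.+ (coeff (f ⊗ g) i j ℚ.+ coeff (f ⊗ h) i j)
    ≡⟨ interchange (coeff (mono c k l ⊗ g) i j) (coeff (mono c k l ⊗ h) i j) (coeff (f ⊗ g) i j) (coeff (f ⊗ h) i j) ⟩
  (coeff (mono c k l ⊗ g) i j ℚ.+ coeff (f ⊗ g) i j) ℚ.+ (coeff (mono c k l ⊗ h) i j ℚ.+ coeff (f ⊗ h) i j)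
    ≡⟨ sym (cong₂ ℚ._+_ (coeff-∷-⊗ c k l f g i j) (coeff-∷-⊗ c k l f h i j)) ⟩
  coeff (((c , k , l) ∷ f) ⊗ g) i j ℚ.+ coeff (((c , k , l) ∷ f) ⊗ h) i j
    ≡⟨ sym (coeff-++ (((c , k , l) ∷ f) ⊗ g) _ i j) ⟩
  coeff (((c , k , l) ∷ f) ⊗ g ⊕ ((c , k , l) ∷ f) ⊗ h) i j ∎
  where open ≡-Reasoning

⊗-comm : ∀ f g → f ⊗ g ≈ g ⊗ f
⊗-comm [] g i j = sym (cong (λ x → coeff x i j) (⊗-[] g))
⊗-comm ((c , k , l) ∷ f) g i j = begin
  coeff (((c , k , l) ∷ f) ⊗ g) i j
    ≡⟨ coeff-∷-⊗ c k l f g i j ⟩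
  coeff (mono c k l ⊗ g) i j ℚ.+ coeff (f ⊗ g) i j
    ≡⟨ cong₂ ℚ._+_ (cong (λ x → coeff x i j) (mono-⊗-mono c k l g)) (⊗-comm f g i j) ⟩
  coeff (g ⊗ mono c k l) i j ℚ.+ coeff (g ⊗ f) i j
    ≡⟨ sym (trans (⊗-distribˡ g (mono c k l) f i j) (coeff-++ (g ⊗ mono c k l) _ i j)) ⟩
  coeff (g ⊗ ((c , k , l) ∷ f)) i j ∎
  where open ≡-Reasoning

mono-⊗-assocˡ : ∀ c k l g h → (mono c k l ⊗ g) ⊗ h ≈ mono c k l ⊗ (g ⊗ h)
mono-⊗-assocˡ c k l [] h i j = refl
mono-⊗-assocˡ c k l ((d , k′ , l′) ∷ g) h i j = begin
  coeff ((mono c k l ⊗ ((d , k′ , l′) ∷ g)) ⊗ h) i j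
    ≡⟨ coeff-∷-⊗ (c ℚ.* d) (k ℕ.+ k′) (l ℤ.+ l′) (mono c k l ⊗ g) h i j ⟩
  coeff (mono (c ℚ.* d) (k ℕ.+ k′) (l ℤ.+ l′) ⊗ h) i j ℚ.+ coeff ((mono c k l ⊗ g) ⊗ h) i j
    ≡⟨ cong₂ ℚ._+_ (cong (λ x → coeff x i j) (mono-⊗-assoc c k l d k′ l′ h)) (mono-⊗-assocˡ c k l g h i j) ⟩
  coeff (mono c k l ⊗ (mono d k′ l′ ⊗ h)) i j ℚ.+ coeff (mono c k l ⊗ (g ⊗ h)) i j
    ≡⟨ sym (coeff-++ (mono c k l ⊗ (mono d k′ l′ ⊗ h)) _ i j) ⟩
  coeff (mono c k l ⊗ (mono d k′ l′ ⊗ h) ++ mono c k l ⊗ (g ⊗ h)) i j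
    ≡⟨ cong (λ x → coeff x i j) (sym (trans (cong (mono c k l ⊗_) (⊗-∷ d k′ l′ g h)) (mono-⊗-++ c k l (mono d k′ l′ ⊗ h) (g ⊗ h)))) ⟩
  coeff (mono c k l ⊗ (((d , k′ , l′) ∷ g) ⊗ h)) i j ∎
  where open ≡-Reasoning

⊗-assoc : ∀ f g h → (f ⊗ g) ⊗ h ≈ f ⊗ (g ⊗ h)
⊗-assoc [] g h i j = refl
⊗-assoc ((c , k , l) ∷ f) g h i j = begin
  coeff ((((c , k , l) ∷ f) ⊗ g) ⊗ h) i j
    ≡⟨ cong (λ x → coeff x i j) (trans (cong (_⊗ h) (⊗-∷ c k l f g)) (++-⊗ (mono c k l ⊗ g) (f ⊗ g) h)) ⟩
  coeff ((mono c k l ⊗ g) ⊗ h ++ (f ⊗ g) ⊗ h) i j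
    ≡⟨ coeff-++ ((mono c k l ⊗ g) ⊗ h) _ i j ⟩
  coeff ((mono c k l ⊗ g) ⊗ h) i j ℚ.+ coeff ((f ⊗ g) ⊗ h) i j
    ≡⟨ cong₂ ℚ._+_ (mono-⊗-assocˡ c k l g h i j) (⊗-assoc f g h i j) ⟩
  coeff (mono c k l ⊗ (g ⊗ h)) i j ℚ.+ coeff (f ⊗ (g ⊗ h)) i j
    ≡⟨ sym (coeff-∷-⊗ c k l f (g ⊗ h) i j) ⟩
  coeff (((c , k , l) ∷ f) ⊗ (g ⊗ h)) i j ∎
  where open ≡-Reasoning

coeff-mono-⊗ : ∀ c k l g i j → coeff (mono c k l ⊗ g) (k ℕ.+ i) (l ℤ.+ j) ≡ c ℚ.* coeff g i j
coeff-mono-⊗ c k l [] i j = sym (ℚP.*-zeroʳ c)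
coeff-mono-⊗ c k l ((d , k′ , l′) ∷ g) i j
  with k′ ℕ.≟ i | l′ ℤ.≟ j | k ℕ.+ k′ ℕ.≟ k ℕ.+ i | l ℤ.+ l′ ℤ.≟ l ℤ.+ j
... | yes _    | yes _    | yes _  | yes _  =
  trans (cong (c ℚ.* d ℚ.+_) (coeff-mono-⊗ c k l g i j)) (sym (ℚP.*-distribˡ-+ c d _))
... | no _     | _        | no _   | _      = coeff-mono-⊗ c k l g i j
... | yes _    | no _     | yes _  | no _   = coeff-mono-⊗ c k l g i j
... | yes k′≡i | _        | no ≢   | _      = ⊥-elim (≢ (cong (k ℕ.+_) k′≡i))
... | no ≢     | _        | yes eq | _      = ⊥-elim (≢ (ℕP.+-cancelˡ-≡ k k′ i eq))
... | yes _    | yes l′≡j | yes _  | no ≢   = ⊥-elim (≢ (cong (ℤ._+_ l) l′≡j))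
... | yes _    | no ≢     | yes _  | yes eq = ⊥-elim (≢ (ℤ-+-cancelˡ l l′ j eq))

coeff-mono-⊗-below : ∀ c k l g i j → ¬ k ≤ i → coeff (mono c k l ⊗ g) i j ≡ 0ℚ
coeff-mono-⊗-below c k l [] i j k≰i = refl
coeff-mono-⊗-below c k l ((d , k′ , l′) ∷ g) i j k≰i with k ℕ.+ k′ ℕ.≟ i
... | yes eq = ⊥-elim (k≰i (subst (k ≤_) eq (ℕP.m≤m+n k k′)))
... | no _   = coeff-mono-⊗-below c k l g i j k≰i

shifted-point : ∀ k l i j → k ≤ i → (k ℕ.+ (i ∸ k) , l ℤ.+ (j ℤ.- l)) ≡ (i , j)
shifted-point k l i j k≤i = cong₂ _,_ (ℕP.m+[n∸m]≡n k≤i) (trans (ℤP.+-comm l (j ℤ.- l)) (ℤ-[j-l]+l≡j l j))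

mono-⊗-congʳ : ∀ c k l g g′ → g ≈ g′ → mono c k l ⊗ g ≈ mono c k l ⊗ g′
mono-⊗-congʳ c k l g g′ g≈g′ i j with k ℕ.≤? i
... | no k≰i = trans (coeff-mono-⊗-below c k l g i j k≰i) (sym (coeff-mono-⊗-below c k l g′ i j k≰i))
... | yes k≤i = subst (λ { (i , j) → coeff (mono c k l ⊗ g) i j ≡ coeff (mono c k l ⊗ g′) i j })
  (shifted-point k l i j k≤i)
  (trans (coeff-mono-⊗ c k l g (i ∸ k) (j ℤ.- l))
    (trans (cong (c ℚ.*_) (g≈g′ (i ∸ k) (j ℤ.- l))) (sym (coeff-mono-⊗ c k l g′ (i ∸ k) (j ℤ.- l)))))

⊗-congʳ : ∀ f g g′ → g ≈ g′ → f ⊗ g ≈ f ⊗ g′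
⊗-congʳ [] g g′ g≈g′ i j = refl
⊗-congʳ ((c , k , l) ∷ f) g g′ g≈g′ i j =
  trans (coeff-∷-⊗ c k l f g i j)
    (trans (cong₂ ℚ._+_ (mono-⊗-congʳ c k l g g′ g≈g′ i j) (⊗-congʳ f g g′ g≈g′ i j))
      (sym (coeff-∷-⊗ c k l f g′ i j)))

⊗-identityˡ : ∀ f → mono 1ℚ 0 (+ 0) ⊗ f ≈ f
⊗-identityˡ f i j = subst (λ j′ → coeff (mono 1ℚ 0 (+ 0) ⊗ f) i j′ ≡ coeff f i j) (ℤP.+-identityˡ j)
  (trans (coeff-mono-⊗ 1ℚ 0 (+ 0) f i j) (ℚP.*-identityˡ _))

-- Since
-- ≈ unfolds to a function type, which hides its arguments from unification,
-- the ring structure uses the following wrapped copy of it.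
infix 4 _≋_
record _≋_ (f g : LPoly) : Set where
  constructor wrap
  field unwrap : f ≈ g
open _≋_ public

≋-isEquivalence : IsEquivalence _≋_
≋-isEquivalence = record
  { refl  = wrap (λ i j → refl)
  ; sym   = λ (wrap f≈g) → wrap (λ i j → sym (f≈g i j))
  ; trans = λ (wrap f≈g) (wrap g≈h) → wrap (λ i j → trans (f≈g i j) (g≈h i j))
  }

⊕-cong : ∀ f f′ g g′ → f ≈ f′ → g ≈ g′ → f ⊕ g ≈ f′ ⊕ g′
⊕-cong f f′ g g′ f≈f′ g≈g′ i j =
  trans (coeff-++ f g i j) (trans (cong₂ ℚ._+_ (f≈f′ i j) (g≈g′ i j)) (sym (coeff-++ f′ g′ i j)))

⊕-comm : ∀ f g → f ⊕ g ≈ g ⊕ f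
⊕-comm f g i j = trans (coeff-++ f g i j) (trans (ℚP.+-comm (coeff f i j) (coeff g i j)) (sym (coeff-++ g f i j)))

neg-cong : ∀ f g → f ≈ g → neg f ≈ neg g
neg-cong f g f≈g i j = trans (coeff-neg f i j) (trans (cong ℚ.-_ (f≈g i j)) (sym (coeff-neg g i j)))

⊕-inverseˡ : ∀ f → neg f ⊕ f ≈ []
⊕-inverseˡ f i j = trans (coeff-++ (neg f) f i j) (trans (cong (ℚ._+ coeff f i j) (coeff-neg f i j)) (ℚP.+-inverseˡ (coeff f i j)))

⊗-cong : ∀ f f′ g g′ → f ≈ f′ → g ≈ g′ → f ⊗ g ≈ f′ ⊗ g′
⊗-cong f f′ g g′ f≈f′ g≈g′ i j =
  trans (⊗-congʳ f g g′ g≈g′ i j)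
    (trans (⊗-comm f g′ i j) (trans (⊗-congʳ g′ f f′ f≈f′ i j) (⊗-comm g′ f′ i j)))

LPoly-commutativeRing : CommutativeRing _ _
LPoly-commutativeRing = record
  { Carrier = LPoly
  ; _≈_ = _≋_
  ; _+_ = _⊕_
  ; _*_ = _⊗_
  ; -_ = neg
  ; 0# = []
  ; 1# = mono 1ℚ 0 (+ 0)
  ; isCommutativeRing = record
    { isRing = record
      { +-isAbelianGroup = record
        { isGroup = record
          { isMonoid = record
            { isSemigroup = record
              { isMagma = record
                { isEquivalence = ≋-isEquivalence
                ; ∙-cong = λ {f} {f′} {g} {g′} (wrap f≈f′) (wrap g≈g′) → wrap (⊕-cong f f′ g g′ f≈f′ g≈g′)
                }
              ; assoc = λ f g h → wrap (λ i j → cong (λ x → coeff x i j) (ListP.++-assoc f g h))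
              }
            ; identity = (λ f → wrap (λ i j → refl))
                       , (λ f → wrap (λ i j → cong (λ x → coeff x i j) (ListP.++-identityʳ f)))
            }
          ; inverse = (λ f → wrap (⊕-inverseˡ f))
                    , (λ f → wrap (λ i j → trans (⊕-comm f (neg f) i j) (⊕-inverseˡ f i j)))
          ; ⁻¹-cong = λ {f} {g} (wrap f≈g) → wrap (neg-cong f g f≈g)
          }
        ; comm = λ f g → wrap (⊕-comm f g)
        }
      ; *-cong = λ {f} {f′} {g} {g′} (wrap f≈f′) (wrap g≈g′) → wrap (⊗-cong f f′ g g′ f≈f′ g≈g′)
      ; *-assoc = λ f g h → wrap (⊗-assoc f g h)
      ; *-identity = (λ f → wrap (⊗-identityˡ f))
                   , (λ f → wrap (λ i j → trans (⊗-comm f (mono 1ℚ 0 (+ 0)) i j) (⊗-identityˡ f i j)))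
      ; distrib = (λ f g h → wrap (⊗-distribˡ f g h))
                , (λ f g h → wrap (λ i j → cong (λ x → coeff x i j) (++-⊗ g h f)))
      }
    ; *-comm = λ f g → wrap (⊗-comm f g)
    }
  }

-- The ring solver for LPoly.  Its normal forms have coefficients in ℚ, embedded
-- as constants c·A⁰·B⁰; since equality in ℚ is decidable, identities solved
-- this way are checked by computation.
LPoly-almostCommutativeRing : SolverRing.AlmostCommutativeRing _ _
LPoly-almostCommutativeRing = SolverRing.fromCommutativeRing LPoly-commutativeRing

const : ℚ → LPoly
const c = mono c 0 (+ 0)

const-morphism : ℚ.+-*-rawRing SolverRing.-Raw-AlmostCommutative⟶ LPoly-almostCommutativeRing
const-morphism = record
  { ⟦_⟧    = const
  ; +-homo = λ a b → wrap (mono-+ a b 0 (+ 0))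
  ; *-homo = λ a b → wrap (λ i j → refl)
  ; -‿homo = λ a → wrap (λ i j → refl)
  ; 0-homo = wrap (mono-0 0 (+ 0))
  ; 1-homo = wrap (λ i j → refl)
  }

module LPoly-Solver = Algebra.Solver.Ring ℚ.+-*-rawRing LPoly-almostCommutativeRing const-morphism
  (λ a b → Data.Maybe.map (λ a≡b → wrap (λ i j → cong (λ c → coeff (const c) i j) a≡b)) (dec⇒maybe (a ℚP.≟ b)))

-- Equality f ≈ g is decidable: it suffices to compare coefficients at the
-- exponents occurring in f ⊕ g, since all other coefficients vanish.

AgreesAt : LPoly → LPoly → ℚ × ℕ × ℤ → Set
AgreesAt f g (_ , i , j) = coeff f i j ≡ coeff g i j

Avoids : ℕ → ℤ → ℚ × ℕ × ℤ → Set
Avoids i j (_ , k , l) = ¬ (k ≡ i × l ≡ j)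

coeff-off-support : ∀ f i j → All (Avoids i j) f → coeff f i j ≡ 0ℚ
coeff-off-support [] i j [] = refl
coeff-off-support ((c , k , l) ∷ f) i j (avoid ∷ avoids) with k ℕ.≟ i | l ℤ.≟ j
... | yes k≡i | yes l≡j = ⊥-elim (avoid (k≡i , l≡j))
... | yes _   | no _    = coeff-off-support f i j avoids
... | no _    | _       = coeff-off-support f i j avoids

agrees-or-avoids : ∀ f g i j h → All (AgreesAt f g) h →
  coeff f i j ≡ coeff g i j ⊎ All (Avoids i j) h
agrees-or-avoids f g i j [] [] = inj₂ []
agrees-or-avoids f g i j ((c , k , l) ∷ h) (agree ∷ agrees) with k ℕ.≟ i | l ℤ.≟ j
... | yes refl | yes refl = inj₁ agree
... | yes _    | no l≢j   = Data.Sum.map₂ ((λ (_ , l≡j) → l≢j l≡j) ∷_) (agrees-or-avoids f g i j h agrees)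
... | no k≢i   | _        = Data.Sum.map₂ ((λ (k≡i , _) → k≢i k≡i) ∷_) (agrees-or-avoids f g i j h agrees)

≈-from-support : ∀ f g → All (AgreesAt f g) (f ⊕ g) → f ≈ g
≈-from-support f g agrees i j with agrees-or-avoids f g i j (f ⊕ g) agrees
... | inj₁ agree  = agree
... | inj₂ avoids = trans (coeff-off-support f i j (AllP.++⁻ˡ f avoids))
                      (sym (coeff-off-support g i j (AllP.++⁻ʳ f avoids)))

agrees-on-support? : ∀ f g → Dec (All (AgreesAt f g) (f ⊕ g))
agrees-on-support? f g = all? (λ { (_ , i , j) → coeff f i j ℚP.≟ coeff g i j }) (f ⊕ g)

≈-by-computation : ∀ f g {agrees : True (agrees-on-support? f g)} → f ≈ g
≈-by-computation f g {agrees} = ≈-from-support f g (toWitness agrees)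

-- The Casoratian identity behind the recurrence for ψ, a polynomial identity
-- proved here in LPoly: if x₅ = m₁x₄ − m₂x₂ and x₆ = n₁x₅ − n₂x₃ (likewise
-- for y), then x₅y₆ − x₆y₅ = n₂m₁(x₃y₄ − x₄y₃) + n₂m₂(x₂y₃ − x₃y₂).
casoratian : ∀ (m₁ m₂ n₁ n₂ x₂ x₃ x₄ y₂ y₃ y₄ : LPoly) →
  (m₁ ⊗ x₄ ⊖ m₂ ⊗ x₂) ⊗ (n₁ ⊗ (m₁ ⊗ y₄ ⊖ m₂ ⊗ y₂) ⊖ n₂ ⊗ y₃)
    ⊖ (n₁ ⊗ (m₁ ⊗ x₄ ⊖ m₂ ⊗ x₂) ⊖ n₂ ⊗ x₃) ⊗ (m₁ ⊗ y₄ ⊖ m₂ ⊗ y₂)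
  ≋ (n₂ ⊗ m₁) ⊗ (x₃ ⊗ y₄ ⊖ x₄ ⊗ y₃) ⊕ (n₂ ⊗ m₂) ⊗ (x₂ ⊗ y₃ ⊖ x₃ ⊗ y₂)
casoratian = solve 10 (λ m₁ m₂ n₁ n₂ x₂ x₃ x₄ y₂ y₃ y₄ →
  (m₁ :* x₄ :- m₂ :* x₂) :* (n₁ :* (m₁ :* y₄ :- m₂ :* y₂) :- n₂ :* y₃)
    :- (n₁ :* (m₁ :* x₄ :- m₂ :* x₂) :- n₂ :* x₃) :* (m₁ :* y₄ :- m₂ :* y₂)
  := (n₂ :* m₁) :* (x₃ :* y₄ :- x₄ :* y₃) :+ (n₂ :* m₂) :* (x₂ :* y₃ :- x₃ :* y₂))
  (wrap (λ i j → refl))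
  where open LPoly-Solver

-- For n = 5 + m the defining recurrence reads
--   α_n = μ₁ m · α_{n−1} − μ₂ m · α_{n−3}  (likewise β_n),
-- with μ₁ m = κ₁ m · A/B and μ₂ m = κ₂ m · 1/B, where κ₁ m = −(2n−3)/(2n)
-- and κ₂ m = (2n−9)/(2n).
ratio : ℕ → ℕ → ℚ
ratio r m = (+ (2 * n) ℤ.- + r) ℚ./ (2 * n) where n = 5 + m

κ₁ κ₂ : ℕ → ℚ
κ₁ m = ℚ.- ratio 3 m
κ₂ m = ratio 9 m

μ₁ μ₂ : ℕ → LPoly
μ₁ m = mono (κ₁ m) 1 (ℤ.- + 1)
μ₂ m = mono (κ₂ m) 0 (ℤ.- + 1)

ψ-recurrence : ∀ m → ψ (5 + m) ≋ (μ₂ (suc m) ⊗ μ₁ m) ⊗ ψ (3 + m) ⊕ (μ₂ (suc m) ⊗ μ₂ m) ⊗ ψ (2 + m)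
ψ-recurrence m = casoratian (μ₁ m) (μ₂ m) (μ₁ (suc m)) (μ₂ (suc m))
  (α (2 + m)) (α (3 + m)) (α (4 + m)) (β (2 + m)) (β (3 + m)) (β (4 + m))

-- The combined coefficients q₁ m, q₂ m of A/B² ψ_{3+m} and 1/B² ψ_{2+m}.
q₁ q₂ : ℕ → ℚ
q₁ m = κ₂ (suc m) ℚ.* κ₁ m
q₂ m = κ₂ (suc m) ℚ.* κ₂ m

scale : ℚ → ℕ → ℕ → Poly2 → Poly2
scale q a b = map (λ { (c , i , j) → (q ℚ.* c , a + i , b + j) })

evalDivB-scale : ∀ q a b d P →
  mono q a -[1+ 1 ] ⊗ evalDivB P d ≡ evalDivB (scale q a b P) (b + (2 + d))
evalDivB-scale q a b d [] = refl
evalDivB-scale q a b d ((c , i , j) ∷ P) =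
  cong₂ _∷_ (cong (λ e → (q ℚ.* c , a + i , e)) exponent) (evalDivB-scale q a b d P)
  where
  open Data.Integer.Solver.+-*-Solver
  exponent : -[1+ 1 ] ℤ.+ (+ j ℤ.- + d) ≡ + (b + j) ℤ.- + (b + (2 + d))
  exponent rewrite ℤP.pos-+ b j | ℤP.pos-+ b (2 + d) | ℤP.pos-+ 2 d =
    solve 3 (λ b j d → con -[1+ 1 ] :+ (j :- d) := (b :+ j) :- (b :+ (con (+ 2) :+ d))) refl (+ b) (+ j) (+ d)

evalDivB-++ : ∀ P Q d → evalDivB (P ++ Q) d ≡ evalDivB P d ⊕ evalDivB Q d
evalDivB-++ P Q d = ListP.map-++ _ P Q

Ψ-step : ℕ → ℕ → Poly2 → Poly2 → Poly2
Ψ-step m b P Q = scale (q₁ m) 1 0 P ++ scale (q₂ m) 0 b Q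

ψ-step : ∀ m b P Q d e → ψ (3 + m) ≈ evalDivB P d → ψ (2 + m) ≈ evalDivB Q e →
  b + (2 + e) ≡ 2 + d → ψ (5 + m) ≈ evalDivB (Ψ-step m b P Q) (2 + d)
ψ-step m b P Q d e ψ₃≈P ψ₂≈Q exponents = unwrap (begin
  ψ (5 + m)
    ≈⟨ ψ-recurrence m ⟩
  (μ₂ (suc m) ⊗ μ₁ m) ⊗ ψ (3 + m) ⊕ (μ₂ (suc m) ⊗ μ₂ m) ⊗ ψ (2 + m)
    ≈⟨ wrap (⊕-cong (M₁ ⊗ ψ (3 + m)) (M₁ ⊗ evalDivB P d) (M₂ ⊗ ψ (2 + m)) (M₂ ⊗ evalDivB Q e)
                     (⊗-congʳ M₁ (ψ (3 + m)) (evalDivB P d) ψ₃≈P) (⊗-congʳ M₂ (ψ (2 + m)) (evalDivB Q e) ψ₂≈Q)) ⟩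
  (μ₂ (suc m) ⊗ μ₁ m) ⊗ evalDivB P d ⊕ (μ₂ (suc m) ⊗ μ₂ m) ⊗ evalDivB Q e
    ≡⟨ cong₂ _⊕_ (evalDivB-scale (q₁ m) 1 0 d P) (evalDivB-scale (q₂ m) 0 b e Q) ⟩
  evalDivB (scale (q₁ m) 1 0 P) (2 + d) ⊕ evalDivB (scale (q₂ m) 0 b Q) (b + (2 + e))
    ≡⟨ cong (λ k → evalDivB (scale (q₁ m) 1 0 P) (2 + d) ⊕ evalDivB (scale (q₂ m) 0 b Q) k) exponents ⟩
  evalDivB (scale (q₁ m) 1 0 P) (2 + d) ⊕ evalDivB (scale (q₂ m) 0 b Q) (2 + d)
    ≡⟨ sym (evalDivB-++ (scale (q₁ m) 1 0 P) _ (2 + d)) ⟩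
  evalDivB (Ψ-step m b P Q) (2 + d) ∎)
  where
  open import Relation.Binary.Reasoning.Setoid (CommutativeRing.setoid LPoly-commutativeRing)
  M₁ = μ₂ (suc m) ⊗ μ₁ m
  M₂ = μ₂ (suc m) ⊗ μ₂ m

-- Doubling by recursion, so that ψ (double n) unfolds along the recurrence.
double : ℕ → ℕ
double zero = zero
double (suc n) = suc (suc (double n))

double≡2* : ∀ n → double n ≡ 2 * n
double≡2* zero = refl
double≡2* (suc n) = trans (cong (λ k → suc (suc k)) (double≡2* n)) (sym (ℕP.*-suc 2 n))

mutual
  Ψ-even : ℕ → Poly2
  Ψ-even 0 = []
  Ψ-even 1 = (ℚ.- (+ 1 ℚ./ 8) , 1 , 0) ∷ []
  Ψ-even 2 = (+ 1 ℚ./ 640 , 2 , 0) ∷ []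
  Ψ-even (suc (suc (suc t))) = Ψ-step (suc (double t)) 0 (Ψ-even (suc (suc t))) (Ψ-odd (suc (suc t)))

  Ψ-odd : ℕ → Poly2
  Ψ-odd 0 = []
  Ψ-odd 1 = (+ 1 ℚ./ 8 , 2 , 0) ∷ []
  Ψ-odd 2 = (+ 1 ℚ./ 32 , 3 , 0) ∷ (+ 3 ℚ./ 16 , 0 , 2) ∷ []
  Ψ-odd (suc (suc (suc t))) = Ψ-step (double t) 2 (Ψ-odd (suc (suc t))) (Ψ-even (suc t))

mutual
  ψ-even : ∀ t → ψ (double (suc t)) ≈ evalDivB (Ψ-even (suc t)) (double (suc t))
  ψ-even 0 = ≈-by-computation (ψ 2) (evalDivB (Ψ-even 1) 2)
  ψ-even 1 = ≈-by-computation (ψ 4) (evalDivB (Ψ-even 2) 4)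
  ψ-even (suc (suc t)) = ψ-step (suc (double t)) 0 (Ψ-even (2 + t)) (Ψ-odd (2 + t)) (double (2 + t)) (double (2 + t))
    (ψ-even (suc t)) (ψ-odd (suc t)) refl

  ψ-odd : ∀ t → ψ (suc (double t)) ≈ evalDivB (Ψ-odd (suc t)) (double (suc t))
  ψ-odd 0 = ≈-by-computation (ψ 1) (evalDivB (Ψ-odd 1) 2)
  ψ-odd 1 = ≈-by-computation (ψ 3) (evalDivB (Ψ-odd 2) 4)
  ψ-odd (suc (suc t)) = ψ-step (double t) 2 (Ψ-odd (2 + t)) (Ψ-even (1 + t)) (double (2 + t)) (double (1 + t))
    (ψ-odd (suc t)) (ψ-even t) refl

↧ₙ-∣ : ∀ q (w z : ℤ) → ℚ.↧ q ℤ.* w ≡ z → ℚ.↧ₙ q ∣ ℤ.∣ z ∣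
↧ₙ-∣ q w z eq = divides ℤ.∣ w ∣
  (trans (sym (cong ℤ.∣_∣ eq)) (trans (ℤP.abs-* (ℚ.↧ q) w) (ℕP.*-comm (ℚ.↧ₙ q) ℤ.∣ w ∣)))

module Localisation (p : ℕ) (p-prime : Prime p) where

  p∤-* : ∀ {a b} → ¬ p ∣ a → ¬ p ∣ b → ¬ p ∣ a * b
  p∤-* {a} {b} p∤a p∤b p∣ab with euclidsLemma a b p-prime p∣ab
  ... | inj₁ p∣a = p∤a p∣a
  ... | inj₂ p∣b = p∤b p∣b

  p∤-small : ∀ k → suc k < p → ¬ p ∣ suc k
  p∤-small k k<p p∣k = ℕP.<⇒≱ k<p (∣⇒≤ p∣k)

  InZp-/ : ∀ z k .{{_ : ℕ.NonZero k}} → ¬ p ∣ k → InZp p (z ℚ./ k)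
  InZp-/ z k p∤k p∣den = p∤k (∣-trans p∣den (↧ₙ-∣ (z ℚ./ k) _ (+ k) (ℚP.↧-/ z k)))

  InZp-neg : ∀ q → InZp p q → InZp p (ℚ.- q)
  InZp-neg q q∈ p∣den = q∈ (subst (p ∣_) (cong ℤ.∣_∣ (ℚP.↧-neg q)) p∣den)

  InZp-* : ∀ a b → InZp p a → InZp p b → InZp p (a ℚ.* b)
  InZp-* a b a∈ b∈ p∣den = p∤-* a∈ b∈ (∣-trans p∣den (subst (ℚ.↧ₙ (a ℚ.* b) ∣_)
    (ℤP.abs-* (ℚ.↧ a) (ℚ.↧ b)) (↧ₙ-∣ (a ℚ.* b) _ (ℚ.↧ a ℤ.* ℚ.↧ b) (ℚP.↧-* a b))))

-- The Ψ's lie in ℤ_(p)[z₄, z₆] and are weighted homogeneous, as long as the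
-- recurrence only divides by 2k with k < p.
module Integrality (p : ℕ) (p-prime : Prime p) (2<p : 2 < p) where
  open Localisation p p-prime

  -- All denominators met below are powers of 2 times numbers below p.
  p∤2^ : ∀ k → ¬ p ∣ 2 ℕ.^ k
  p∤2^ zero = p∤-small 0 (ℕP.<-trans (ℕP.n<1+n 1) 2<p)
  p∤2^ (suc k) = p∤-* (p∤-small 1 2<p) (p∤2^ k)

  InZp-ratio : ∀ r m → 6 + m ≤ p → InZp p (ratio r m)
  InZp-ratio r m 6+m≤p = InZp-/ (+ (2 * (5 + m)) ℤ.- + r) (2 * (5 + m))
    (p∤-* (p∤2^ 1) (p∤-small (4 + m) 6+m≤p))

  InZp-κ : ∀ m → 6 + m ≤ p → InZp p (κ₁ m) × InZp p (κ₂ m)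
  InZp-κ m 6+m≤p = InZp-neg (ratio 3 m) (InZp-ratio 3 m 6+m≤p) , InZp-ratio 9 m 6+m≤p

  InZp-q : ∀ m → 7 + m ≤ p → InZp p (q₁ m) × InZp p (q₂ m)
  InZp-q m 7+m≤p = InZp-* (κ₂ (suc m)) (κ₁ m) κ₂′ (proj₁ κ) , InZp-* (κ₂ (suc m)) (κ₂ m) κ₂′ (proj₂ κ)
    where
    κ = InZp-κ m (ℕP.≤-trans (ℕP.n≤1+n (6 + m)) 7+m≤p)
    κ₂′ = proj₂ (InZp-κ (suc m) 7+m≤p)

  scale-WHom : ∀ q a b w P → InZp p q → IsWHomZp p w P →
    IsWHomZp p (4 * a + 6 * b + w) (scale q a b P)
  scale-WHom q a b w [] q∈ [] = []
  scale-WHom q a b w ((c , i , j) ∷ P) q∈ ((c∈ , weight) ∷ P-hom) =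
    (InZp-* q c q∈ c∈ , trans (weights a b i j) (cong (λ w′ → 4 * a + 6 * b + w′) weight)) ∷ scale-WHom q a b w P q∈ P-hom
    where
    weights : ∀ a b i j → 4 * (a + i) + 6 * (b + j) ≡ 4 * a + 6 * b + (4 * i + 6 * j)
    weights = solve-∀

  Ψ-step-WHom : ∀ m b P Q d d₁ d₂ → 7 + m ≤ p → IsWHomZp p d₁ P → IsWHomZp p d₂ Q →
    4 + d₁ ≡ d → 6 * b + d₂ ≡ d → IsWHomZp p d (Ψ-step m b P Q)
  Ψ-step-WHom m b P Q d d₁ d₂ 7+m≤p P-hom Q-hom P-deg Q-deg = AllP.++⁺
    (subst (λ w → IsWHomZp p w (scale (q₁ m) 1 0 P)) P-deg (scale-WHom (q₁ m) 1 0 d₁ P (proj₁ (InZp-q m 7+m≤p)) P-hom))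
    (subst (λ w → IsWHomZp p w (scale (q₂ m) 0 b Q)) Q-deg (scale-WHom (q₂ m) 0 b d₂ Q (proj₂ (InZp-q m 7+m≤p)) Q-hom))

  lower : ∀ n → 3 + double (suc n) ≤ p → 3 + double n ≤ p
  lower n = ℕP.≤-trans (ℕP.m≤n+m (3 + double n) 2)

  mutual
    Ψ-even-WHom : ∀ n → 3 + double n ≤ p → IsWHomZp p (4 * n) (Ψ-even n)
    Ψ-even-WHom 0 _ = []
    Ψ-even-WHom 1 _ = (InZp-neg (+ 1 ℚ./ 8) (InZp-/ (+ 1) (2 ℕ.^ 3) (p∤2^ 3)) , refl) ∷ []
    Ψ-even-WHom 2 7≤p = (InZp-/ (+ 1) (2 ℕ.^ 7 * 5) (p∤-* (p∤2^ 7) (p∤-small 4 (ℕP.≤-trans (ℕP.n≤1+n 6) 7≤p))) , refl) ∷ []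
    Ψ-even-WHom (suc (suc (suc t))) bound = Ψ-step-WHom _ 0 _ _ _ _ _
      (ℕP.≤-trans (ℕP.n≤1+n _) bound)
      (Ψ-even-WHom (suc (suc t)) (lower (2 + t) bound)) (Ψ-odd-WHom (suc (suc t)) (lower (2 + t) bound))
      (even-first t) (even-second t)
      where
      even-first : ∀ t → 4 + 4 * (2 + t) ≡ 4 * (3 + t)
      even-first = solve-∀
      even-second : ∀ t → 4 * (2 + t) + 4 ≡ 4 * (3 + t)
      even-second = solve-∀

    Ψ-odd-WHom : ∀ n → 3 + double n ≤ p → IsWHomZp p (4 * n + 4) (Ψ-odd n)
    Ψ-odd-WHom 0 _ = []
    Ψ-odd-WHom 1 _ = (InZp-/ (+ 1) (2 ℕ.^ 3) (p∤2^ 3) , refl) ∷ []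
    Ψ-odd-WHom 2 _ = (InZp-/ (+ 1) (2 ℕ.^ 5) (p∤2^ 5) , refl) ∷ (InZp-/ (+ 3) (2 ℕ.^ 4) (p∤2^ 4) , refl) ∷ []
    Ψ-odd-WHom (suc (suc (suc t))) bound = Ψ-step-WHom _ 2 _ _ _ _ _
      (lower (2 + t) bound)
      (Ψ-odd-WHom (suc (suc t)) (lower (2 + t) bound)) (Ψ-even-WHom (suc t) (lower (1 + t) (lower (2 + t) bound)))
      (odd-first t) (odd-second t)
      where
      odd-first : ∀ t → 4 + (4 * (2 + t) + 4) ≡ 4 * (3 + t) + 4
      odd-first = solve-∀
      odd-second : ∀ t → 6 * 2 + 4 * (1 + t) ≡ 4 * (3 + t) + 4
      odd-second = solve-∀

bound : ∀ p n → 1 ≤ n → n ≤ (p ∸ 3) / 2 → 3 + double n ≤ p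
bound p n 1≤n n≤[p-3]/2 = subst (λ k → 3 + k ≤ p) (sym (double≡2* n))
  (subst (_≤ p) (ℕP.+-comm (2 * n) 3) (ℕP.m≤o∸n⇒m+n≤o (2 * n) 3≤p 2n≤p∸3))
  where
  2n≤p∸3 : 2 * n ≤ p ∸ 3
  2n≤p∸3 = ℕP.≤-trans (ℕP.*-monoʳ-≤ 2 n≤[p-3]/2)
    (subst (_≤ p ∸ 3) (ℕP.*-comm ((p ∸ 3) / 2) 2) (ℕDivMod.m/n*n≤m (p ∸ 3) 2))
  3≤p : 3 ≤ p
  3≤p = ℕP.<⇒≤ (ℕP.m∸n≢0⇒n<m (λ p∸3≡0 →
    ℕP.<⇒≱ 1≤n (ℕP.≤-trans (ℕP.m≤n*m n 2) (subst (2 * n ≤_) p∸3≡0 2n≤p∸3))))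

-- The theorem.  The exclusions p ≠ 2, 3 are implied by the bound, which forces
-- p ≥ 5; n = 0 is excluded by 1 ≤ n.
proposition4p3 : (p : ℕ) → Prime p → p ≢ 2 → p ≢ 3 →
    (n : ℕ) → 1 ≤ n → n ≤ (p ∸ 3) / 2 →
    Σ Poly2 (λ Ψeven → Σ Poly2 (λ Ψodd →
      IsWHomZp p (4 * n) Ψeven × IsWHomZp p (4 * n + 4) Ψodd ×
      ψ (2 * n) ≈ evalDivB Ψeven (2 * n) ×
      ψ (2 * n ∸ 1) ≈ evalDivB Ψodd (2 * n)))
proposition4p3 p p-prime _ _ n@(suc t) 1≤n n≤[p-3]/2 =
  Ψ-even n , Ψ-odd n , Ψ-even-WHom n 3+2n≤p , Ψ-odd-WHom n 3+2n≤p ,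
  subst (λ k → ψ k ≈ evalDivB (Ψ-even n) k) (double≡2* n) (ψ-even t) ,
  subst (λ k → ψ (k ∸ 1) ≈ evalDivB (Ψ-odd n) k) (double≡2* n) (ψ-odd t)
  where
  3+2n≤p : 3 + double n ≤ p
  3+2n≤p = bound p n 1≤n n≤[p-3]/2
  open Integrality p p-prime (ℕP.≤-trans (ℕP.m≤m+n 3 (double n)) 3+2n≤p)
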